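{- For every BI frame $\mathcal{X}=(X,\preccurlyeq,\circ,E)$, every persistent valuation $\mathcal{V}$, every $x\in X$ and every BI formula $\varphi$: $\mathcal{X},x\vDash_{\mathcal{V}}\varphi$ if and only if $\mathcal{X}^{\Uparrow\Downarrow},x\vDash'_{\mathcal{V}}\varphi$.
   Context: BI formulas: $\varphi::=p\mid\top\mid\bot\mid\top^*\mid\varphi\wedge\varphi\mid\varphi\vee\varphi\mid\varphi\to\varphi\mid\varphi*\varphi\mid\varphi\mathbin{ -\!\!*}\varphi$. BI frame: $(X,\preccurlyeq,\circ,E)$ with $\preccurlyeq$ a preorder, $\circ:X^2\to\mathcal{P}(X)$, $E\subseteq X$, satisfying (Commutativity) $z\in x\circ y\to z\in y\circ x$; (Closure) $e\in E\wedge e'\succcurlyeq e\to e'\in E$; (Unit Existence) $\exists e\in E(x\in x\circ e)$; (Coherence) $e\in E\wedge x\in y\circ e\to x\succcurlyeq y$; (Associativity) $t'\succcurlyeq t\in x\circ y\wedge w\in t'\circ z\to\exists s,s',w'(s'\succcurlyeq s\in y\circ z\wedge w\succcurlyeq w'\in x\circ s')$. A persistent valuation maps atoms to upward-closed sets. $\mathcal{X}^{\Uparrow\Downarrow}=(X,\preccurlyeq,\circ^{\Uparrow\Downarrow},E)$ where $x\in y\circ^{\Uparrow\Downarrow}z$ iff there exist $x'\preccurlyeq x$, $y'\succcurlyeq y$, $z'\succcurlyeq z$ with $x'\in y'\circ z'$. $\vDash_{\mathcal{V}}$: $x\vDash p$ iff $x\in\mathcal{V}(p)$; $\top$ always, $\bot$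 never; $\wedge,\vee$ pointwise; $x\vDash\varphi\to\psi$ iff for all $y\succcurlyeq x$, $y\vDash\varphi\Rightarrow y\vDash\psi$; $x\vDash\top^*$ iff $x\in E$; $x\vDash\varphi*\psi$ iff $\exists x',y,z$ with $x\succcurlyeq x'\in y\circ z$, $y\vDash\varphi$, $z\vDash\psi$; $x\vDash\varphi\mathbin{ -\!\!*}\psi$ iff for all $x',y,z$ with $x'\succcurlyeq x$, $z\in x'\circ y$: $y\vDash\varphi\Rightarrow z\vDash\psi$. $\vDash'_{\mathcal{V}}$ (on $\mathcal{X}^{\Uparrow\Downarrow}$): same clauses for atoms, $\top,\bot,\wedge,\vee,\to,\top^*$, but $x\vDash'\varphi*\psi$ iff $\exists y,z$ with $x\in y\circ^{\Uparrow\Downarrow}z$, $y\vDash'\varphi$, $z\vDash'\psi$; and $x\vDash'\varphi\mathbin{ -\!\!*}\psi$ iff for all $y,z$ with $z\in x\circ^{\Uparrow\Downarrow}y$, $y\vDash'\varphi\Rightarrow z\vDash'\psi$. -}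

module Defs where

open import Level using (Level; _⊔_; suc)
open import Data.Nat using (ℕ)
open import Data.Product using (Σ; _×_; ∃; ∃-syntax; _,_)
open import Data.Empty.Polymorphic using (⊥)
open import Data.Unit.Polymorphic using (⊤)
open import Data.Sum using (_⊎_)
open import Relation.Binary.Structures using (IsPreorder)
open import Relation.Binary.PropositionalEquality using (_≡_)

data Formula : Set where
  atom  : ℕ → Formula
  ⊤ᶠ    : Formula
  ⊥ᶠ    : Formula
  ⊤*    : Formula
  _∧ᶠ_  : Formula → Formula → Formula
  _∨ᶠ_  : Formula → Formula → Formula
  _⇒ᶠ_  : Formula → Formula → Formula
  _✱_   : Formula → Formula → Formula
  _—✱_  : Formula → Formula → Formula

record BIFrame (a ℓ : Level) : Set (Level.suc (a ⊔ ℓ)) where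
  field
    X         : Set a
    _≼_       : X → X → Set ℓ
    _∈_∘_     : X → X → X → Set ℓ
    E         : X → Set ℓ
    ≼-preorder : IsPreorder _≡_ _≼_
    commutativity : ∀ {x y z} → z ∈ x ∘ y → z ∈ y ∘ x
    closure       : ∀ {e e'} → E e → e ≼ e' → E e'
    unitExistence : ∀ x → ∃[ e ] (E e × x ∈ x ∘ e)
    coherence     : ∀ {e x y} → E e → x ∈ y ∘ e → y ≼ x
    associativity : ∀ {t t' x y z w} → t ≼ t' → t ∈ x ∘ y → w ∈ t' ∘ z →
                    ∃[ s ] ∃[ s' ] ∃[ w' ]
                      (s ≼ s' × s ∈ y ∘ z × w' ≼ w × w' ∈ x ∘ s')

module _ {a ℓ : Level} (𝒳 : BIFrame a ℓ) where
  open BIFrame 𝒳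

  record PersistentValuation : Set (a ⊔ Level.suc ℓ) where
    field
      V          : ℕ → X → Set ℓ
      persistent : ∀ {p x y} → x ≼ y → V p x → V p y

  _∈_∘⇑⇓_ : X → X → X → Set (a ⊔ ℓ)
  x ∈ y ∘⇑⇓ z = ∃[ x' ] ∃[ y' ] ∃[ z' ]
                  (x' ≼ x × y ≼ y' × z ≼ z' × x' ∈ y' ∘ z')

  -- the frame X^{⇑⇓} (its underlying preorder and unit set are those of X)
  -- Forcing relation ⊨ on X
  module Sat (𝒱 : PersistentValuation) where
    open PersistentValuation 𝒱

    _⊨_ : X → Formula → Set (a ⊔ ℓ)
    x ⊨ atom p   = Level.Lift (a ⊔ ℓ) (V p x)
    x ⊨ ⊤ᶠ       = ⊤
    x ⊨ ⊥ᶠ       = ⊥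
    x ⊨ ⊤*       = Level.Lift (a ⊔ ℓ) (E x)
    x ⊨ (φ ∧ᶠ ψ) = x ⊨ φ × x ⊨ ψ
    x ⊨ (φ ∨ᶠ ψ) = x ⊨ φ ⊎ x ⊨ ψ
    x ⊨ (φ ⇒ᶠ ψ) = ∀ y → x ≼ y → y ⊨ φ → y ⊨ ψ
    x ⊨ (φ ✱ ψ)  = ∃[ x' ] ∃[ y ] ∃[ z ]
                     (x' ≼ x × x' ∈ y ∘ z × y ⊨ φ × z ⊨ ψ)
    x ⊨ (φ —✱ ψ) = ∀ x' y z → x ≼ x' → z ∈ x' ∘ y → y ⊨ φ → z ⊨ ψ

    _⊨'_ : X → Formula → Set (a ⊔ ℓ)
    x ⊨' atom p   = Level.Lift (a ⊔ ℓ) (V p x)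
    x ⊨' ⊤ᶠ       = ⊤
    x ⊨' ⊥ᶠ       = ⊥
    x ⊨' ⊤*       = Level.Lift (a ⊔ ℓ) (E x)
    x ⊨' (φ ∧ᶠ ψ) = x ⊨' φ × x ⊨' ψ
    x ⊨' (φ ∨ᶠ ψ) = x ⊨' φ ⊎ x ⊨' ψ
    x ⊨' (φ ⇒ᶠ ψ) = ∀ y → x ≼ y → y ⊨' φ → y ⊨' ψ
    x ⊨' (φ ✱ ψ)  = ∃[ y ] ∃[ z ] (x ∈ y ∘⇑⇓ z × y ⊨' φ × z ⊨' ψ)
    x ⊨' (φ —✱ ψ) = ∀ y z → z ∈ x ∘⇑⇓ y → y ⊨' φ → z ⊨' ψ

-- The closure ∘⇑⇓ only adds triples obtained from ∘ by lowering the
-- result and raising the arguments, and forcing is persistent. So for ✱ the raised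
-- arguments still force their formulas, while the lowering of the result is absorbed by the
-- existing "x ≽ x'" clause. For —✱, forcing at the lowered result persists up to the actual one.
module Submission where

open import Defs
open import Level using (Level; lift)
open import Function.Bundles using (_⇔_; mk⇔)
open import Data.Product using (_,_)
open import Data.Sum using (inj₁; inj₂)
open import Relation.Binary.Structures using (IsPreorder)

module _ {a ℓ : Level} (𝒳 : BIFrame a ℓ) (𝒱 : PersistentValuation 𝒳) where
  open BIFrame 𝒳
  open IsPreorder ≼-preorder using (refl; trans)
  open PersistentValuation 𝒱
  open Sat 𝒳 𝒱

  ⊨-persistent : ∀ φ {x y} → x ≼ y → x ⊨ φ → y ⊨ φ
  ⊨-persistent (atom p) x≼y (lift v)  = lift (persistent x≼y v)
  ⊨-persistent ⊤ᶠ       x≼y h         = h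
  ⊨-persistent ⊤*       x≼y (lift e)  = lift (closure e x≼y)
  ⊨-persistent (φ ∧ᶠ ψ) x≼y (h , k)   = ⊨-persistent φ x≼y h , ⊨-persistent ψ x≼y k
  ⊨-persistent (φ ∨ᶠ ψ) x≼y (inj₁ h)  = inj₁ (⊨-persistent φ x≼y h)
  ⊨-persistent (φ ∨ᶠ ψ) x≼y (inj₂ h)  = inj₂ (⊨-persistent ψ x≼y h)
  ⊨-persistent (φ ⇒ᶠ ψ) x≼y h w y≼w   = h w (trans x≼y y≼w)
  ⊨-persistent (φ ✱ ψ)  x≼y (x' , y , z , x'≼x , r , hy , hz) =
    x' , y , z , trans x'≼x x≼y , r , hy , hz
  ⊨-persistent (φ —✱ ψ) x≼y h x' y z y≼x' = h x' y z (trans x≼y y≼x')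

  ⊨⇒⊨' : ∀ φ {x} → x ⊨ φ → x ⊨' φ
  ⊨'⇒⊨ : ∀ φ {x} → x ⊨' φ → x ⊨ φ

  ⊨⇒⊨' (atom p) h        = h
  ⊨⇒⊨' ⊤ᶠ       h        = h
  ⊨⇒⊨' ⊤*       h        = h
  ⊨⇒⊨' (φ ∧ᶠ ψ) (h , k)  = ⊨⇒⊨' φ h , ⊨⇒⊨' ψ k
  ⊨⇒⊨' (φ ∨ᶠ ψ) (inj₁ h) = inj₁ (⊨⇒⊨' φ h)
  ⊨⇒⊨' (φ ∨ᶠ ψ) (inj₂ h) = inj₂ (⊨⇒⊨' ψ h)
  ⊨⇒⊨' (φ ⇒ᶠ ψ) h w x≼w hw = ⊨⇒⊨' ψ (h w x≼w (⊨'⇒⊨ φ hw))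
  ⊨⇒⊨' (φ ✱ ψ)  (x' , y , z , x'≼x , r , hy , hz) =
    y , z , (x' , y , z , x'≼x , refl , refl , r) , ⊨⇒⊨' φ hy , ⊨⇒⊨' ψ hz
  ⊨⇒⊨' (φ —✱ ψ) h y z (z' , x' , y' , z'≼z , x≼x' , y≼y' , r) hy =
    ⊨⇒⊨' ψ (⊨-persistent ψ z'≼z (h x' y' z' x≼x' r (⊨-persistent φ y≼y' (⊨'⇒⊨ φ hy))))

  ⊨'⇒⊨ (atom p) h        = h
  ⊨'⇒⊨ ⊤ᶠ       h        = h
  ⊨'⇒⊨ ⊤*       h        = h
  ⊨'⇒⊨ (φ ∧ᶠ ψ) (h , k)  = ⊨'⇒⊨ φ h , ⊨'⇒⊨ ψ k
  ⊨'⇒⊨ (φ ∨ᶠ ψ) (inj₁ h) = inj₁ (⊨'⇒⊨ φ h)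
  ⊨'⇒⊨ (φ ∨ᶠ ψ) (inj₂ h) = inj₂ (⊨'⇒⊨ ψ h)
  ⊨'⇒⊨ (φ ⇒ᶠ ψ) h w x≼w hw = ⊨'⇒⊨ ψ (h w x≼w (⊨⇒⊨' φ hw))
  ⊨'⇒⊨ (φ ✱ ψ)  (y , z , (x' , y' , z' , x'≼x , y≼y' , z≼z' , r) , hy , hz) =
    x' , y' , z' , x'≼x , r ,
    ⊨-persistent φ y≼y' (⊨'⇒⊨ φ hy) , ⊨-persistent ψ z≼z' (⊨'⇒⊨ ψ hz)
  ⊨'⇒⊨ (φ —✱ ψ) h x' y z x≼x' r hy =
    ⊨'⇒⊨ ψ (h y z (z , x' , y , refl , x≼x' , refl , r) (⊨⇒⊨' φ hy))

proposition4p5 : ∀ {a ℓ : Level} (𝒳 : BIFrame a ℓ) (𝒱 : PersistentValuation 𝒳)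
                 (x : BIFrame.X 𝒳) (φ : Formula) →
                 (Sat._⊨_ 𝒳 𝒱 x φ) ⇔ (Sat._⊨'_ 𝒳 𝒱 x φ)
proposition4p5 𝒳 𝒱 x φ = mk⇔ (⊨⇒⊨' 𝒳 𝒱 φ) (⊨'⇒⊨ 𝒳 𝒱 φ)
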